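{- Let $g$ be a positive integer and let $S'$ be a child of $S$ in the ordinarization tree $\mathcal{T}_g$. Write $S'=S\setminus\{a\}\cup\{b\}$ with $a\in S$ and $b\in\mathbb{N}_0\setminus S$. Then $a\in\mathrm{eg}(S)$ and $\left\lceil\frac{m(S)}{2}\right\rceil\le b\le m(S)-1$.
   Context: For a numerical semigroup $S$ (additive submonoid of $\mathbb{N}_0$ with finite complement), $F(S)$ is the largest gap, $m(S)$ the smallest nonzero element, and the genus is the number of gaps. $S_g=\{0,g+1,g+2,\ldots\}$. A numerical semigroup $S'\neq S_g$ of genus $g$ is a child of $S$ in $\mathcal{T}_g$ if $S'\cup\{F(S')\}\setminus\{m(S')\}=S$. $\mathrm{eg}(S)$ denotes the set of minimal generators of $S$ larger than $F(S)$ (effective generators). -}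

module Defs where

open import Data.Nat using (ℕ; zero; suc; _+_; _≤_; _<_; _<ᵇ_; _≡ᵇ_)
open import Data.Bool using (Bool; true; false; if_then_else_; _∧_; _∨_; not)
open import Data.Product using (_×_; Σ; ∃)
open import Relation.Binary.PropositionalEquality using (_≡_; _≢_)
open import Relation.Nullary using (¬_)

_∈S_ : ℕ → (ℕ → Bool) → Set
n ∈S S = S n ≡ true

record IsNumericalSemigroup (S : ℕ → Bool) : Set where
  field
    zero∈   : 0 ∈S S
    closed  : ∀ x y → x ∈S S → y ∈S S → (x + y) ∈S S
    cofinite : ∃ λ N → ∀ n → N ≤ n → n ∈S S

gapsBelow : (ℕ → Bool) → ℕ → ℕ
gapsBelow S zero = 0
gapsBelow S (suc N) = gapsBelow S N + (if S N then 0 else 1)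

HasGenus : (ℕ → Bool) → ℕ → Set
HasGenus S g = ∃ λ N → (∀ n → N ≤ n → n ∈S S) × gapsBelow S N ≡ g

-- S_g = {0, g+1, g+2, ...}
ordinary : ℕ → ℕ → Bool
ordinary g zero = true
ordinary g (suc n) = g <ᵇ suc n

IsFrobenius : (ℕ → Bool) → ℕ → Set
IsFrobenius S f = (S f ≡ false) × (∀ n → f < n → n ∈S S)

IsMultiplicity : (ℕ → Bool) → ℕ → Set
IsMultiplicity S m = (0 < m) × (m ∈S S) × (∀ n → 0 < n → n ∈S S → m ≤ n)

IsMinimalGenerator : (ℕ → Bool) → ℕ → Set
IsMinimalGenerator S x =
  (x ∈S S) × (0 < x) ×
  (∀ y z → 0 < y → 0 < z → y ∈S S → z ∈S S → y + z ≢ x)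

-- x ∈ eg(S): minimal generator larger than F(S)
-- (x > F(S) written as: every gap of S is < x; vacuous when S = ℕ₀)
IsEffectiveGenerator : (ℕ → Bool) → ℕ → Set
IsEffectiveGenerator S x =
  IsMinimalGenerator S x × (∀ n → S n ≡ false → n < x)

-- S' is a child of S in the ordinarization tree T_g:
-- S' ≠ S_g numerical semigroup of genus g with S' ∪ {F(S')} \ {m(S')} = S
IsChild : ℕ → (ℕ → Bool) → (ℕ → Bool) → Set
IsChild g S S' =
  IsNumericalSemigroup S' × HasGenus S' g × ¬ (∀ n → S' n ≡ ordinary g n) ×
  Σ ℕ (λ f → Σ ℕ (λ m → IsFrobenius S' f × IsMultiplicity S' m ×
    (∀ n → S n ≡ ((S' n ∨ (n ≡ᵇ f)) ∧ not (n ≡ᵇ m)))))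

-- Removing m(S') from S' and adding F(S') back gives S, so the swap S' = S ∖ {a} ∪ {b}
-- forces a = F(S') and b = m(S'); this needs m(S') < F(S'), since otherwise S' = {0} ∪ [m(S'), ∞)
-- would be the excluded ordinary semigroup S_g. Then F(S') is a minimal generator of S, because a
-- decomposition into smaller elements of S would already lie in S', and every gap of S is below it.
-- Finally m(S') < m(S) ≤ 2 m(S'), as 2 m(S') ∈ S' ∖ {m(S')} ⊆ S.
module Submission where

open import Defs
open import Data.Nat using (ℕ; zero; suc; _+_; _∸_; _<_; _≤_; z≤n; z<s; ⌈_/2⌉; _≡ᵇ_; _<ᵇ_)
open import Data.Nat.Properties
open import Data.Bool using (Bool; true; false; _∧_; _∨_; not)
open import Data.Bool.Properties using (T-≡; not-¬; ∧-zeroʳ; ∨-zeroʳ)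
open import Data.Product using (_×_; _,_; proj₁; proj₂; uncurry)
open import Function.Bundles using (Equivalence)
open import Relation.Binary.PropositionalEquality using (_≡_; _≢_; refl; sym; trans; cong; subst; module ≡-Reasoning)
open import Relation.Binary.Definitions using (tri<; tri≈; tri>)
open import Relation.Nullary using (¬_; contradiction; yes; no)
open import Relation.Nullary.Reflects using (Reflects; ofʸ; ofⁿ; fromEquivalence)

≡ᵇ-reflects-≡ : ∀ m n → Reflects (m ≡ n) (m ≡ᵇ n)
≡ᵇ-reflects-≡ m n = fromEquivalence (≡ᵇ⇒≡ m n) (≡⇒≡ᵇ m n)

≡ᵇ-refl : ∀ n → (n ≡ᵇ n) ≡ true
≡ᵇ-refl n with n ≡ᵇ n | ≡ᵇ-reflects-≡ n n
... | true  | _        = refl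
... | false | ofⁿ n≢n = contradiction refl n≢n

≢⇒≡ᵇ≡false : ∀ {m n} → m ≢ n → (m ≡ᵇ n) ≡ false
≢⇒≡ᵇ≡false {m} {n} m≢n with m ≡ᵇ n | ≡ᵇ-reflects-≡ m n
... | false | _        = refl
... | true  | ofʸ m≡n = contradiction m≡n m≢n

≮⇒<ᵇ≡false : ∀ {m n} → ¬ m < n → (m <ᵇ n) ≡ false
≮⇒<ᵇ≡false {m} {n} m≮n with m <ᵇ n | <ᵇ-reflects-< m n
... | false | _        = refl
... | true  | ofʸ m<n = contradiction m<n m≮n

⌈n/2⌉≤m×m≤n∸1 : ∀ {m n} → m < n → n ≤ m + m → ⌈ n /2⌉ ≤ m × m ≤ n ∸ 1
⌈n/2⌉≤m×m≤n∸1 {m} m<n n≤2m =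
  ≤-trans (⌈n/2⌉-mono n≤2m) (≤-reflexive (sym (n≡⌈n+n/2⌉ m))) , <⇒≤pred m<n

gapsBelow-cong : ∀ {S S′ : ℕ → Bool} → (∀ n → S n ≡ S′ n) → ∀ N → gapsBelow S N ≡ gapsBelow S′ N
gapsBelow-cong S≗S′ zero    = refl
gapsBelow-cong S≗S′ (suc N) rewrite gapsBelow-cong S≗S′ N | S≗S′ N = refl

gapsBelow-+ : ∀ {S N} → (∀ n → N ≤ n → n ∈S S) → ∀ d → gapsBelow S (N + d) ≡ gapsBelow S N
gapsBelow-+ {S} {N} _ zero = cong (gapsBelow S) (+-identityʳ N)
gapsBelow-+ {S} {N} tail (suc d)
  rewrite +-suc N d | tail (N + d) (m≤m+n N d) | gapsBelow-+ tail d = +-identityʳ (gapsBelow S N)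

hasGenus⇒gapsBelow≡ : ∀ {S g M} → HasGenus S g → (∀ n → M ≤ n → n ∈S S) → gapsBelow S M ≡ g
hasGenus⇒gapsBelow≡ {S} {g} {M} (N , N-tail , gapsN≡g) M-tail = begin
  gapsBelow S M       ≡⟨ sym (gapsBelow-+ M-tail N) ⟩
  gapsBelow S (M + N) ≡⟨ cong (gapsBelow S) (+-comm M N) ⟩
  gapsBelow S (N + M) ≡⟨ gapsBelow-+ N-tail M ⟩
  gapsBelow S N       ≡⟨ gapsN≡g ⟩
  g                   ∎
  where open ≡-Reasoning

gapsBelow-ordinary : ∀ {k} j → j ≤ k → gapsBelow (ordinary k) (suc j) ≡ j
gapsBelow-ordinary zero    _     = refl
gapsBelow-ordinary {k} (suc j) j<k
  rewrite gapsBelow-ordinary j (<⇒≤ j<k) | ≮⇒<ᵇ≡false (≤⇒≯ j<k) = +-comm j 1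

genus-ordinary : ∀ {S g k} → (∀ n → S n ≡ ordinary k n) → HasGenus S g → g ≡ k
genus-ordinary {S} {g} {k} S≗Sₖ genus = begin
  g                              ≡⟨ sym (hasGenus⇒gapsBelow≡ genus above-k) ⟩
  gapsBelow S (suc k)            ≡⟨ gapsBelow-cong S≗Sₖ (suc k) ⟩
  gapsBelow (ordinary k) (suc k) ≡⟨ gapsBelow-ordinary k ≤-refl ⟩
  k                              ∎
  where
  open ≡-Reasoning
  above-k : ∀ n → suc k ≤ n → n ∈S S
  above-k (suc n) k<n = trans (S≗Sₖ (suc n)) (Equivalence.to T-≡ (<⇒<ᵇ k<n))

frobenius<multiplicity⇒ordinary : ∀ {S f k} → 0 ∈S S → IsFrobenius S f →
  IsMultiplicity S (suc k) → f < suc k → ∀ n → S n ≡ ordinary k n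
frobenius<multiplicity⇒ordinary 0∈S _ _ _ zero = 0∈S
frobenius<multiplicity⇒ordinary {S} {k = k} 0∈S (_ , above-f) (_ , _ , minimal) f<m (suc n)
  with k <ᵇ suc n | <ᵇ-reflects-< k (suc n)
... | true  | ofʸ k<n = above-f (suc n) (<-≤-trans f<m k<n)
... | false | ofⁿ k≮n with S (suc n) in n∈S
...   | false = refl
...   | true  = contradiction (minimal (suc n) z<s n∈S) k≮n

nonordinary⇒multiplicity<frobenius : ∀ {S g f m} → IsNumericalSemigroup S → HasGenus S g →
  ¬ (∀ n → S n ≡ ordinary g n) → IsFrobenius S f → IsMultiplicity S m → m < f
nonordinary⇒multiplicity<frobenius {S} {g} {f} {m} S-ns genus S≢Sg frob@(f∉S , _) mult@(_ , m∈S , _)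
  with <-cmp m f
... | tri< m<f _ _ = m<f
... | tri≈ _ m≡f _ = contradiction (subst (λ x → S x ≡ false) (sym m≡f) f∉S) (not-¬ m∈S)
... | tri> _ _ f<m = contradiction (ordinary-of-genus mult f<m) S≢Sg
  where
  ordinary-of-genus : ∀ {μ} → IsMultiplicity S μ → f < μ → ∀ n → S n ≡ ordinary g n
  ordinary-of-genus {suc k} mult f<μ n =
    subst (λ j → S n ≡ ordinary j n) (sym (genus-ordinary S≗Sₖ genus)) (S≗Sₖ n)
    where
    S≗Sₖ : ∀ n → S n ≡ ordinary k n
    S≗Sₖ = frobenius<multiplicity⇒ordinary (IsNumericalSemigroup.zero∈ S-ns) frob mult f<μ

module SwapUniqueness {S S′ : ℕ → Bool} {a b : ℕ}
  (S′≡ : ∀ n → S′ n ≡ ((S n ∧ not (n ≡ᵇ a)) ∨ (n ≡ᵇ b))) where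

  removed≡ : ∀ {n} → n ∈S S → S′ n ≡ false → n ≡ a
  removed≡ {n} n∈S n∉S′ with n ≡ᵇ a | ≡ᵇ-reflects-≡ n a | S′≡ n
  ... | true  | ofʸ n≡a | _     = n≡a
  ... | false | _       | S′n≡ rewrite n∈S = contradiction n∉S′ (not-¬ S′n≡)

  added≡ : ∀ {n} → S n ≡ false → n ∈S S′ → n ≡ b
  added≡ {n} n∉S n∈S′ with n ≡ᵇ b | ≡ᵇ-reflects-≡ n b | S′≡ n
  ... | true  | ofʸ n≡b | _     = n≡b
  ... | false | _       | S′n≡ rewrite n∉S = contradiction S′n≡ (not-¬ n∈S′)

module Ordinarization {S S′ : ℕ → Bool} {f m : ℕ}
  (S≡ : ∀ n → S n ≡ ((S′ n ∨ (n ≡ᵇ f)) ∧ not (n ≡ᵇ m))) where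

  m∉S : S m ≡ false
  m∉S rewrite S≡ m | ≡ᵇ-refl m = ∧-zeroʳ _

  f∈S : f ≢ m → f ∈S S
  f∈S f≢m rewrite S≡ f | ≡ᵇ-refl f | ≢⇒≡ᵇ≡false f≢m | ∨-zeroʳ (S′ f) = refl

  S⊆S′ : ∀ {n} → n ∈S S → n ≢ f → n ∈S S′
  S⊆S′ {n} n∈S n≢f with S′ n | S≡ n
  ... | true  | _   = refl
  ... | false | S≡n rewrite ≢⇒≡ᵇ≡false n≢f = contradiction S≡n (not-¬ n∈S)

  S′⊆S : ∀ {n} → n ∈S S′ → n ≢ m → n ∈S S
  S′⊆S {n} n∈S′ n≢m rewrite S≡ n | n∈S′ | ≢⇒≡ᵇ≡false n≢m = refl

  module _ (S′-ns : IsNumericalSemigroup S′) (frob : IsFrobenius S′ f)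
           (mult : IsMultiplicity S′ m) (m<f : m < f) where
    open IsNumericalSemigroup S′-ns using (closed)

    frobenius-effective : IsEffectiveGenerator S f
    frobenius-effective = (f∈S (>⇒≢ m<f) , ≤-<-trans z≤n m<f , indecomposable) , gaps<f
      where
      indecomposable : ∀ y z → 0 < y → 0 < z → y ∈S S → z ∈S S → y + z ≢ f
      indecomposable y z y>0 z>0 y∈S z∈S y+z≡f =
        contradiction (proj₁ frob) (not-¬ (subst (_∈S S′) y+z≡f (closed y z y∈S′ z∈S′)))
        where
        y∈S′ : y ∈S S′
        y∈S′ = S⊆S′ y∈S (<⇒≢ (subst (y <_) y+z≡f (m<m+n y z>0)))
        z∈S′ : z ∈S S′
        z∈S′ = S⊆S′ z∈S (<⇒≢ (subst (z <_) (trans (+-comm z y) y+z≡f) (m<m+n z y>0)))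
      gaps<f : ∀ n → S n ≡ false → n < f
      gaps<f n n∉S with <-cmp n f
      ... | tri< n<f _ _ = n<f
      ... | tri≈ _ n≡f _ = contradiction (subst (λ x → S x ≡ false) n≡f n∉S) (not-¬ (f∈S (>⇒≢ m<f)))
      ... | tri> _ _ f<n = contradiction n∉S (not-¬ (S′⊆S (proj₂ frob n f<n) (>⇒≢ (<-trans m<f f<n))))

    multiplicity-bounds : ∀ {μ} → IsMultiplicity S μ → m < μ × μ ≤ m + m
    multiplicity-bounds {μ} (μ>0 , μ∈S , S-minimal) = m<μ , μ≤2m
      where
      m≤μ : m ≤ μ
      m≤μ with μ ≟ f
      ... | yes μ≡f = subst (m ≤_) (sym μ≡f) (<⇒≤ m<f)
      ... | no  μ≢f = proj₂ (proj₂ mult) μ μ>0 (S⊆S′ μ∈S μ≢f)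
      m<μ : m < μ
      m<μ = ≤∧≢⇒< m≤μ (λ m≡μ → contradiction (subst (λ x → S x ≡ false) m≡μ m∉S) (not-¬ μ∈S))
      μ≤2m : μ ≤ m + m
      μ≤2m = S-minimal (m + m) (≤-trans (proj₁ mult) (m≤m+n m m))
        (S′⊆S (closed m m m∈S′ m∈S′) (>⇒≢ (m<m+n m (proj₁ mult))))
        where
        m∈S′ : m ∈S S′
        m∈S′ = proj₁ (proj₂ mult)

mainTheorem10 : (g : ℕ) → 0 < g → (S S' : ℕ → Bool) →
    IsNumericalSemigroup S → IsChild g S S' →
    (a b : ℕ) → a ∈S S → S b ≡ false →
    (∀ n → S' n ≡ ((S n ∧ not (n ≡ᵇ a)) ∨ (n ≡ᵇ b))) →
    IsEffectiveGenerator S a ×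
      ((m : ℕ) → IsMultiplicity S m → (⌈ m /2⌉ ≤ b) × (b ≤ m ∸ 1))
mainTheorem10 _ _ S S′ _ (S′-ns , genus , S′≢Sg , f , m , frob , mult , S≡) a b _ _ S′≡ =
  subst (IsEffectiveGenerator S) f≡a (frobenius-effective S′-ns frob mult m<f) ,
  λ μ μ-mult → subst (λ x → ⌈ μ /2⌉ ≤ x × x ≤ μ ∸ 1) m≡b
    (uncurry ⌈n/2⌉≤m×m≤n∸1 (multiplicity-bounds S′-ns frob mult m<f μ-mult))
  where
  open Ordinarization S≡
  open SwapUniqueness S′≡
  m<f : m < f
  m<f = nonordinary⇒multiplicity<frobenius S′-ns genus S′≢Sg frob mult
  f≡a : f ≡ a
  f≡a = removed≡ (f∈S (>⇒≢ m<f)) (proj₁ frob)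
  m≡b : m ≡ b
  m≡b = added≡ m∉S (proj₁ (proj₂ mult))
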